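{- For $k\ge0$ let $\mathcal{L}_k=\sum_{j=0}^k L(k,j)$, where $L(k,j)$ is the Lah number (the number of partitions of $\{1,\dots,k\}$ into $j$ nonempty linearly ordered lists, with $L(0,0)=1$), and define the modified Lah polynomials $\mathcal{P}_n(x)=\sum_{k=0}^n\binom nk\mathcal{L}_kx^{n-k}$. Let $p\ge3$ be a prime, $s\ge1$ an integer and $m_0,\dots,m_s\in\{0,\dots,p-1\}$. Then $$\mathcal{P}_{m_0+m_1p+\cdots+m_sp^s}(x)\equiv\left(x^p+1\right)^{m_1}\left(x^{p^2}+1\right)^{m_2}\cdots\left(x^{p^s}+1\right)^{m_s}\mathcal{P}_{m_0}(x)\pmod p.$$ In particular, $$\mathcal{P}_{m_1p+\cdots+m_sp^s}(x)\equiv\left(x^p+1\right)^{m_1}\cdots\left(x^{p^s}+1\right)^{m_s}\pmod p,$$ and for every integer $k$, $\mathcal{P}_{m_1p+\cdots+m_sp^s}(k)\equiv(k+1)^{m_1+\cdots+m_s}\pmod p$.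
   Context: A congruence $P(x)\equiv Q(x)\pmod p$ between polynomials with integer coefficients means that every coefficient of $P(x)-Q(x)$ is divisible by $p$. The polynomials $\mathcal{P}_n(x)$ have exponential generating function $\sum_n\mathcal{P}_n(x)\frac{t^n}{n!}=\exp\!\left(\frac{t}{1-t}\right)e^{xt}$. -}

module Defs where

open import Data.Nat as ℕ using (ℕ; zero; suc; _≤_; _≤?_)
open import Data.Nat.Combinatorics using (_C_)
open import Data.Integer as ℤ using (ℤ; +_; _-_)
open import Data.Integer.Divisibility as ℤD using ()
open import Relation.Nullary using (yes; no)

sumℕ : ℕ → (ℕ → ℕ) → ℕ
sumℕ zero    f = 0
sumℕ (suc n) f = sumℕ n f ℕ.+ f n

sumℤ : ℕ → (ℕ → ℤ) → ℤ
sumℤ zero    f = + 0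
sumℤ (suc n) f = sumℤ n f ℤ.+ f n

-- Lah numbers L(n,k): number of partitions of {1..n} into k nonempty
-- linearly ordered lists, via the standard recurrence
-- L(0,0)=1, L(0,k+1)=0, L(n+1,0)=0, L(n+1,k+1) = (n+k+1) L(n,k+1) + L(n,k)
Lah : ℕ → ℕ → ℕ
Lah zero    zero    = 1
Lah zero    (suc k) = 0
Lah (suc n) zero    = 0
Lah (suc n) (suc k) = (n ℕ.+ suc k) ℕ.* Lah n (suc k) ℕ.+ Lah n k

𝓛 : ℕ → ℕ
𝓛 k = sumℕ (suc k) (Lah k)

-- Polynomials with integer coefficients, as coefficient sequences
-- (coefficient of x^i).  All polynomials used below have finite support.
Poly : Set
Poly = ℕ → ℤ

_·_ : Poly → Poly → Poly
(f · g) n = sumℤ (suc n) (λ i → f i ℤ.* g (n ℕ.∸ i))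

one : Poly
one zero    = + 1
one (suc _) = + 0

_^^_ : Poly → ℕ → Poly
f ^^ zero  = one
f ^^ suc e = f · (f ^^ e)

xPow+1 : ℕ → Poly
xPow+1 e i with i ℕ.≟ e
... | yes _ = + 1 ℤ.+ one i
... | no  _ = one i

-- modified Lah polynomial 𝒫_n(x) = Σ_{k=0}^n C(n,k) 𝓛_k x^{n-k};
-- coefficient of x^i is C(n,n-i) 𝓛_{n-i} for i ≤ n, and 0 otherwise.
𝒫 : ℕ → Poly
𝒫 n i with i ≤? n
... | yes _ = + ((n C (n ℕ.∸ i)) ℕ.* 𝓛 (n ℕ.∸ i))
... | no  _ = + 0

𝒫-eval : ℕ → ℤ → ℤ
𝒫-eval n k = sumℤ (suc n) (λ j → + ((n C j) ℕ.* 𝓛 j) ℤ.* (k ℤ.^ (n ℕ.∸ j)))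

_≡ₚ_[mod_] : Poly → Poly → ℕ → Set
P ≡ₚ Q [mod p ] = ∀ i → (+ p) ℤD.∣ (P i - Q i)

prodFactors : (p : ℕ) → (m : ℕ → ℕ) → ℕ → Poly
prodFactors p m zero    = one
prodFactors p m (suc s) = prodFactors p m s · (xPow+1 (p ℕ.^ suc s) ^^ m (suc s))

digits : (p : ℕ) → (m : ℕ → ℕ) → ℕ → ℕ
digits p m s = sumℕ (suc s) (λ i → m i ℕ.* p ℕ.^ i)

digits₁ : (p : ℕ) → (m : ℕ → ℕ) → ℕ → ℕ
digits₁ p m s = sumℕ s (λ i → m (suc i) ℕ.* p ℕ.^ suc i)

{-# OPTIONS --safe #-}
module Submission where

-- Let q = p^j with j ≥ 1. The inner binomial coefficients C(q,k), 0 < k < q, vanish mod p, so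
-- (1+x)^(n+q) ≡ (1+x)^n (1+x^q), i.e. C(n+q,i) ≡ C(n,i) + C(n,i−q). From k! L(n,k) = n! C(n−1,k−1)
-- we get p ∣ L(p,k) for 0 < k < p, and the Lah recurrence then gives L(n+p,k) ≡ 0 for k < p and
-- L(n+p,k+p) ≡ L(n,k); summing rows, 𝓛 is p-periodic mod p. As the coefficient of x^i in 𝒫_n is
-- C(n,i) 𝓛_(n−i), the two facts combine to 𝒫_(n+q) ≡ (x^q+1) 𝒫_n, and peeling off the digits one
-- power of p at a time gives the polynomial congruences. At x = k, Fermat gives k^q ≡ k, so each
-- factor x^(p^i)+1 evaluates to k+1.

open import Defs
open import Data.Nat using (ℕ; suc; _≤_; _<_)
open import Data.Nat.Primality using (Prime)
open import Data.Integer as ℤ using (ℤ; +_; _-_)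
open import Data.Integer.Divisibility as ℤD using ()
open import Data.Product using (_×_; _,_)

open import Data.Nat as ℕ using (zero; z≤n; s≤s; _∸_; _!)
import Data.Nat.Properties as ℕP
import Data.Nat.Divisibility as ℕD
import Data.Nat.DivMod as ℕDM
open import Data.Nat.Combinatorics using (_C_; nCn≡1; nC1≡n; nCk≡nC[n∸k]; k>n⇒nCk≡0; nCk+nC[k+1]≡[n+1]C[k+1])
open import Data.Nat.Primality using (euclidsLemma; prime⇒nonTrivial)
import Data.Nat.Tactic.RingSolver as ℕ-Solver
import Data.Integer.Properties as ℤP
import Data.Integer.DivMod as ℤDM
import Data.Integer.Divisibility.Signed as Signed
import Data.Integer.Tactic.RingSolver as ℤ-Solver
open import Data.Sum using (inj₁; inj₂)
open import Data.Empty using (⊥-elim)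
open import Function using (_∘_)
open import Level using (0ℓ)
open import Relation.Nullary using (yes; no; ¬_)
open import Relation.Binary.PropositionalEquality
open import Relation.Binary.Bundles using (Setoid)
import Relation.Binary.Reasoning.Setoid

module _ where
  open import Data.Nat using (_+_; _*_)
  open ≡-Reasoning

  pascal : ∀ n k → suc n C suc k ≡ n C k + n C suc k
  pascal n k = sym (nCk+nC[k+1]≡[n+1]C[k+1] n k)

  absorption : ∀ n k → suc k * (suc n C suc k) ≡ suc n * (n C k)
  absorption zero    zero    = refl
  absorption zero    (suc k) rewrite k>n⇒nCk≡0 {1} {suc (suc k)} (s≤s (s≤s z≤n)) | k>n⇒nCk≡0 {0} {suc k} (s≤s z≤n) =
    ℕP.*-zeroʳ (suc (suc k))
  absorption (suc n) zero    = trans (ℕP.*-identityˡ _) (trans (nC1≡n (suc (suc n))) (sym (ℕP.*-identityʳ _)))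
  absorption (suc n) (suc k) = begin
    suc (suc k) * (suc (suc n) C suc (suc k))         ≡⟨ cong (suc (suc k) *_) (pascal (suc n) (suc k)) ⟩
    suc (suc k) * (A + suc n C suc (suc k))           ≡⟨ distribute k A (suc n C suc (suc k)) ⟩
    A + suc k * A + suc (suc k) * (suc n C suc (suc k)) ≡⟨ cong₂ (λ a b → A + a + b) (absorption n k) (absorption n (suc k)) ⟩
    A + suc n * (n C k) + suc n * (n C suc k)          ≡⟨ ℕP.+-assoc A _ _ ⟩
    A + (suc n * (n C k) + suc n * (n C suc k))        ≡⟨ cong (λ c → A + c) (sym (ℕP.*-distribˡ-+ (suc n) (n C k) (n C suc k))) ⟩
    A + suc n * (n C k + n C suc k)                   ≡⟨ cong (λ c → A + suc n * c) (sym (pascal n k)) ⟩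
    suc (suc n) * A                                   ∎
    where
    A = suc n C suc k
    distribute : ∀ k a b → suc (suc k) * (a + b) ≡ a + suc k * a + suc (suc k) * b
    distribute = ℕ-Solver.solve-∀

  -- (k+1) C(n,k+1) = (n−k) C(n,k), with the subtraction moved across.
  absorption-step : ∀ n k → suc k * (n C suc k) + k * (n C k) ≡ n * (n C k)
  absorption-step n k = ℕP.+-cancelʳ-≡ (n C k) _ _ (begin
    suc k * (n C suc k) + k * (n C k) + n C k ≡⟨ regroup k (n C k) (n C suc k) ⟩
    suc k * (n C k + n C suc k)             ≡⟨ cong (suc k *_) (sym (pascal n k)) ⟩
    suc k * (suc n C suc k)                 ≡⟨ absorption n k ⟩
    suc n * (n C k)                         ≡⟨ ℕP.+-comm (n C k) (n * (n C k)) ⟩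
    n * (n C k) + n C k                     ∎)
    where
    regroup : ∀ k a b → suc k * b + k * a + a ≡ suc k * (a + b)
    regroup = ℕ-Solver.solve-∀

  Lah-above-diagonal : ∀ {n k} → n < k → Lah n k ≡ 0
  Lah-above-diagonal {zero}  {suc k} _ = refl
  Lah-above-diagonal {suc n} {suc k} (s≤s n<k)
    rewrite Lah-above-diagonal (ℕP.m<n⇒m<1+n n<k) | Lah-above-diagonal n<k = cong (_+ 0) (ℕP.*-zeroʳ (n + suc k))

  Lah-diagonal : ∀ n → Lah n n ≡ 1
  Lah-diagonal zero    = refl
  Lah-diagonal (suc n) rewrite Lah-above-diagonal (ℕP.n<1+n n) | Lah-diagonal n | ℕP.*-zeroʳ (n + suc n) = refl

  *-Lah-zero : ∀ n → n * Lah n 0 ≡ 0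
  *-Lah-zero zero    = refl
  *-Lah-zero (suc n) = ℕP.*-zeroʳ (suc n)

  Lah-closed-form : ∀ n k → suc k ! * Lah (suc n) (suc k) ≡ suc n ! * (n C k)
  Lah-closed-form zero    zero    = refl
  Lah-closed-form zero    (suc k) rewrite k>n⇒nCk≡0 {0} {suc k} (s≤s z≤n) | ℕP.*-zeroʳ (suc k) =
    ℕP.*-zeroʳ (suc (suc k) !)
  Lah-closed-form (suc n) zero    = begin
    1 * ((suc n + 1) * L + 0)  ≡⟨ regroup (suc n) L ⟩
    (suc n + 1) * (1 * L)      ≡⟨ cong ((suc n + 1) *_) (Lah-closed-form n 0) ⟩
    (suc n + 1) * (suc n ! * 1) ≡⟨ factorial (suc n !) n ⟩
    suc (suc n) ! * 1          ∎
    where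
    L = Lah (suc n) 1
    regroup : ∀ m L → 1 * ((m + 1) * L + 0) ≡ (m + 1) * (1 * L)
    regroup = ℕ-Solver.solve-∀
    factorial : ∀ f n → (suc n + 1) * (f * 1) ≡ (suc (suc n) * f) * 1
    factorial = ℕ-Solver.solve-∀
  Lah-closed-form (suc n) (suc k) = begin
    suc (suc k) ! * ((suc n + suc (suc k)) * Lah (suc n) (suc (suc k)) + Lah (suc n) (suc k))
      ≡⟨ distribute (suc n + suc (suc k)) k (suc k !) (Lah (suc n) (suc (suc k))) (Lah (suc n) (suc k)) ⟩
    (suc n + suc (suc k)) * (suc (suc k) ! * Lah (suc n) (suc (suc k))) + suc (suc k) * (suc k ! * Lah (suc n) (suc k))
      ≡⟨ cong₂ (λ a b → (suc n + suc (suc k)) * a + suc (suc k) * b) (Lah-closed-form n (suc k)) (Lah-closed-form n k) ⟩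
    (suc n + suc (suc k)) * (F * c₁) + suc (suc k) * (F * c₀)
      ≡⟨ regroup n k F c₀ c₁ ⟩
    F * (suc (suc n) * c₁ + (suc k * c₁ + k * c₀) + 2 * c₀)
      ≡⟨ cong (λ x → F * (suc (suc n) * c₁ + x + 2 * c₀)) (absorption-step n k) ⟩
    F * (suc (suc n) * c₁ + n * c₀ + 2 * c₀)
      ≡⟨ factorial n F c₀ c₁ ⟩
    suc (suc n) ! * (c₀ + c₁)
      ≡⟨ cong (suc (suc n) ! *_) (sym (pascal n k)) ⟩
    suc (suc n) ! * (suc n C suc k)
      ∎
    where
    F = suc n !
    c₀ = n C k
    c₁ = n C suc k
    distribute : ∀ a k f L₂ L₁ → (suc (suc k) * f) * (a * L₂ + L₁) ≡ a * ((suc (suc k) * f) * L₂) + suc (suc k) * (f * L₁)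
    distribute = ℕ-Solver.solve-∀
    regroup : ∀ n k F c₀ c₁ → (suc n + suc (suc k)) * (F * c₁) + suc (suc k) * (F * c₀)
                              ≡ F * (suc (suc n) * c₁ + (suc k * c₁ + k * c₀) + 2 * c₀)
    regroup = ℕ-Solver.solve-∀
    factorial : ∀ n F c₀ c₁ → F * (suc (suc n) * c₁ + n * c₀ + 2 * c₀) ≡ (suc (suc n) * F) * (c₀ + c₁)
    factorial = ℕ-Solver.solve-∀

open import Data.Integer using (_+_; _*_; _^_; -_; 0ℤ; 1ℤ)

sumℤ-cong : ∀ n {f g : ℕ → ℤ} → (∀ i → i < n → f i ≡ g i) → sumℤ n f ≡ sumℤ n g
sumℤ-cong zero    f≡g = refl
sumℤ-cong (suc n) f≡g =
  cong₂ _+_ (sumℤ-cong n (λ i i<n → f≡g i (ℕP.m<n⇒m<1+n i<n))) (f≡g n (ℕP.n<1+n n))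

sumℤ-distrib-+ : ∀ n (f g : ℕ → ℤ) → sumℤ n (λ i → f i + g i) ≡ sumℤ n f + sumℤ n g
sumℤ-distrib-+ zero    f g = refl
sumℤ-distrib-+ (suc n) f g rewrite sumℤ-distrib-+ n f g = swap (sumℤ n f) (sumℤ n g) (f n) (g n)
  where
  swap : ∀ a b c d → a + b + (c + d) ≡ a + c + (b + d)
  swap = ℤ-Solver.solve-∀

sumℤ-*ˡ : ∀ n (c : ℤ) (f : ℕ → ℤ) → sumℤ n (λ i → c * f i) ≡ c * sumℤ n f
sumℤ-*ˡ zero    c f = sym (ℤP.*-zeroʳ c)
sumℤ-*ˡ (suc n) c f rewrite sumℤ-*ˡ n c f = sym (ℤP.*-distribˡ-+ c (sumℤ n f) (f n))

sumℤ-*ʳ : ∀ n (c : ℤ) (f : ℕ → ℤ) → sumℤ n (λ i → f i * c) ≡ sumℤ n f * c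
sumℤ-*ʳ zero    c f = refl
sumℤ-*ʳ (suc n) c f rewrite sumℤ-*ʳ n c f = sym (ℤP.*-distribʳ-+ c (sumℤ n f) (f n))

sumℤ-zero : ∀ n (f : ℕ → ℤ) → (∀ i → i < n → f i ≡ 0ℤ) → sumℤ n f ≡ 0ℤ
sumℤ-zero zero    f f≡0 = refl
sumℤ-zero (suc n) f f≡0 =
  cong₂ _+_ (sumℤ-zero n f (λ i i<n → f≡0 i (ℕP.m<n⇒m<1+n i<n))) (f≡0 n (ℕP.n<1+n n))

sumℤ-head : ∀ n (f : ℕ → ℤ) → sumℤ (suc n) f ≡ f 0 + sumℤ n (λ i → f (suc i))
sumℤ-head zero    f = ℤP.+-comm 0ℤ (f 0)
sumℤ-head (suc n) f rewrite sumℤ-head n f = ℤP.+-assoc (f 0) _ _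

sumℤ-split : ∀ a b (f : ℕ → ℤ) → sumℤ (a ℕ.+ b) f ≡ sumℤ a f + sumℤ b (λ i → f (a ℕ.+ i))
sumℤ-split a zero    f rewrite ℕP.+-identityʳ a = sym (ℤP.+-identityʳ _)
sumℤ-split a (suc b) f rewrite ℕP.+-suc a b | sumℤ-split a b f = ℤP.+-assoc (sumℤ a f) _ _

sumℤ-reverse : ∀ n (f : ℕ → ℤ) → sumℤ n f ≡ sumℤ n (λ i → f (n ∸ suc i))
sumℤ-reverse zero    f = refl
sumℤ-reverse (suc n) f rewrite sumℤ-head n (λ i → f (n ∸ i)) | sym (sumℤ-reverse n f) =
  ℤP.+-comm _ (f n)

sumℤ-single : ∀ n c (f : ℕ → ℤ) → c < n → (∀ a → a < n → a ≢ c → f a ≡ 0ℤ) → sumℤ n f ≡ f c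
sumℤ-single (suc n) c f c<1+n f≡0 with c ℕ.≟ n
... | yes refl = begin
  sumℤ c f + f c ≡⟨ cong (_+ f c) (sumℤ-zero c f (λ a a<c → f≡0 a (ℕP.m<n⇒m<1+n a<c) (ℕP.<⇒≢ a<c))) ⟩
  0ℤ + f c       ≡⟨ ℤP.+-identityˡ (f c) ⟩
  f c            ∎
  where open ≡-Reasoning
... | no c≢n = begin
  sumℤ n f + f n ≡⟨ cong₂ _+_ (sumℤ-single n c f c<n (λ a a<n → f≡0 a (ℕP.m<n⇒m<1+n a<n)))
                              (f≡0 n (ℕP.n<1+n n) (c≢n ∘ sym)) ⟩
  f c + 0ℤ       ≡⟨ ℤP.+-identityʳ (f c) ⟩
  f c            ∎
  where
  open ≡-Reasoning
  c<n : c < n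
  c<n = ℕP.≤∧≢⇒< (ℕP.≤-pred c<1+n) c≢n

sumℤ-triangle : ∀ n (G : ℕ → ℕ → ℤ) →
  sumℤ (suc n) (λ i → sumℤ (suc i) (λ j → G j (i ∸ j))) ≡ sumℤ (suc n) (λ j → sumℤ (suc (n ∸ j)) (G j))
sumℤ-triangle zero    G = refl
sumℤ-triangle (suc n) G = begin
  sumℤ (suc n) (λ i → sumℤ (suc i) (λ j → G j (i ∸ j))) + sumℤ (suc (suc n)) (λ j → G j (suc n ∸ j))
    ≡⟨ cong (_+ sumℤ (suc (suc n)) (λ j → G j (suc n ∸ j))) (sumℤ-triangle n G) ⟩
  rows + (diagonal + G (suc n) (n ∸ n))
    ≡⟨ sym (ℤP.+-assoc rows diagonal _) ⟩
  rows + diagonal + G (suc n) (n ∸ n)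
    ≡⟨ cong₂ _+_ (sym (sumℤ-distrib-+ (suc n) _ _)) last-column ⟩
  sumℤ (suc n) (λ j → sumℤ (suc (n ∸ j)) (G j) + G j (suc n ∸ j)) + sumℤ (suc (n ∸ n)) (G (suc n))
    ≡⟨ cong (_+ sumℤ (suc (n ∸ n)) (G (suc n))) (sumℤ-cong (suc n) extend-row) ⟩
  sumℤ (suc n) (λ j → sumℤ (suc (suc n ∸ j)) (G j)) + sumℤ (suc (n ∸ n)) (G (suc n))
    ∎
  where
  open ≡-Reasoning
  rows diagonal : ℤ
  rows     = sumℤ (suc n) (λ j → sumℤ (suc (n ∸ j)) (G j))
  diagonal = sumℤ (suc n) (λ j → G j (suc n ∸ j))
  last-column : G (suc n) (n ∸ n) ≡ sumℤ (suc (n ∸ n)) (G (suc n))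
  last-column rewrite ℕP.n∸n≡0 n = sym (ℤP.+-identityˡ _)
  extend-row : ∀ j → j < suc n → sumℤ (suc (n ∸ j)) (G j) + G j (suc n ∸ j) ≡ sumℤ (suc (suc n ∸ j)) (G j)
  extend-row j (s≤s j≤n) rewrite ℕP.+-∸-assoc 1 j≤n = refl

·-comm : ∀ f g n → (f · g) n ≡ (g · f) n
·-comm f g n = trans (sumℤ-reverse (suc n) _) (sumℤ-cong (suc n) flip)
  where
  flip : ∀ i → i < suc n → f (n ∸ i) * g (n ∸ (n ∸ i)) ≡ g i * f (n ∸ i)
  flip i (s≤s i≤n) rewrite ℕP.m∸[m∸n]≡n i≤n = ℤP.*-comm (f (n ∸ i)) (g i)

·-identityˡ : ∀ g n → (one · g) n ≡ g n
·-identityˡ g n = begin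
  (one · g) n                                     ≡⟨ sumℤ-head n _ ⟩
  1ℤ * g n + sumℤ n (λ i → one (suc i) * g (n ∸ suc i)) ≡⟨ cong₂ _+_ (ℤP.*-identityˡ (g n)) (sumℤ-zero n _ (λ _ _ → refl)) ⟩
  g n + 0ℤ                                        ≡⟨ ℤP.+-identityʳ (g n) ⟩
  g n                                             ∎
  where open ≡-Reasoning

·-assoc : ∀ f g h n → ((f · g) · h) n ≡ (f · (g · h)) n
·-assoc f g h n = begin
  sumℤ (suc n) (λ i → (f · g) i * h (n ∸ i))
    ≡⟨ sumℤ-cong (suc n) (λ i _ → sym (sumℤ-*ʳ (suc i) (h (n ∸ i)) _)) ⟩
  sumℤ (suc n) (λ i → sumℤ (suc i) (λ j → f j * g (i ∸ j) * h (n ∸ i)))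
    ≡⟨ sumℤ-cong (suc n) (λ i _ → sumℤ-cong (suc i) (λ j j<1+i → cong (λ m → f j * g (i ∸ j) * h (n ∸ m))
                                                                       (sym (ℕP.m+[n∸m]≡n (ℕP.≤-pred j<1+i))))) ⟩
  sumℤ (suc n) (λ i → sumℤ (suc i) (λ j → G j (i ∸ j)))
    ≡⟨ sumℤ-triangle n G ⟩
  sumℤ (suc n) (λ j → sumℤ (suc (n ∸ j)) (G j))
    ≡⟨ sumℤ-cong (suc n) (λ j _ → trans (sumℤ-cong (suc (n ∸ j)) (λ l _ → regroup j l)) (sumℤ-*ˡ (suc (n ∸ j)) (f j) _)) ⟩
  sumℤ (suc n) (λ j → f j * (g · h) (n ∸ j))
    ∎
  where
  open ≡-Reasoning
  G : ℕ → ℕ → ℤ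
  G j l = f j * g l * h (n ∸ (j ℕ.+ l))
  regroup : ∀ j l → G j l ≡ f j * (g l * h (n ∸ j ∸ l))
  regroup j l rewrite ℕP.∸-+-assoc n j l = ℤP.*-assoc (f j) (g l) _

xPow+1-other : ∀ q a → a ≢ 0 → a ≢ q → xPow+1 q a ≡ 0ℤ
xPow+1-other q a a≢0 a≢q with a ℕ.≟ q
xPow+1-other q a       a≢0 a≢q | yes a≡q = ⊥-elim (a≢q a≡q)
xPow+1-other q zero    a≢0 a≢q | no _    = ⊥-elim (a≢0 refl)
xPow+1-other q (suc a) a≢0 a≢q | no _    = refl

xPow+1-self : ∀ q → 0 < q → xPow+1 q q ≡ 1ℤ
xPow+1-self q (s≤s z≤n) with q ℕ.≟ q
... | yes _   = refl
... | no q≢q = ⊥-elim (q≢q refl)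

xPow+1-·-low : ∀ {q} → 0 < q → ∀ g i → i < q → (xPow+1 q · g) i ≡ g i
xPow+1-·-low {suc q} _ g i i<q = begin
  (xPow+1 (suc q) · g) i                              ≡⟨ sumℤ-head i _ ⟩
  1ℤ * g i + sumℤ i (λ a → xPow+1 (suc q) (suc a) * g (i ∸ suc a))
    ≡⟨ cong₂ _+_ (ℤP.*-identityˡ (g i)) (sumℤ-zero i _ vanish) ⟩
  g i + 0ℤ                                            ≡⟨ ℤP.+-identityʳ (g i) ⟩
  g i                                                 ∎
  where
  open ≡-Reasoning
  vanish : ∀ a → a < i → xPow+1 (suc q) (suc a) * g (i ∸ suc a) ≡ 0ℤ
  vanish a a<i rewrite xPow+1-other (suc q) (suc a) (λ ()) (λ 1+a≡q → ℕP.<-irrefl 1+a≡q (ℕP.<-≤-trans (s≤s a<i) i<q)) = refl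

xPow+1-·-high : ∀ {q} → 0 < q → ∀ g i → (xPow+1 q · g) (i ℕ.+ q) ≡ g (i ℕ.+ q) + g i
xPow+1-·-high {suc q} 0<q g i = begin
  (xPow+1 (suc q) · g) (i ℕ.+ suc q)                  ≡⟨ sumℤ-head (i ℕ.+ suc q) _ ⟩
  1ℤ * g (i ℕ.+ suc q) + sumℤ (i ℕ.+ suc q) (λ a → X (suc a) * g (i ℕ.+ suc q ∸ suc a))
    ≡⟨ cong₂ _+_ (ℤP.*-identityˡ (g (i ℕ.+ suc q))) (sumℤ-single (i ℕ.+ suc q) q _ q<i+1+q vanish) ⟩
  g (i ℕ.+ suc q) + X (suc q) * g (i ℕ.+ suc q ∸ suc q)
    ≡⟨ cong (λ c → g (i ℕ.+ suc q) + c) (cong₂ _*_ (xPow+1-self (suc q) 0<q) (cong g (ℕP.m+n∸n≡m i (suc q)))) ⟩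
  g (i ℕ.+ suc q) + 1ℤ * g i                          ≡⟨ cong (λ c → g (i ℕ.+ suc q) + c) (ℤP.*-identityˡ (g i)) ⟩
  g (i ℕ.+ suc q) + g i                               ∎
  where
  open ≡-Reasoning
  X = xPow+1 (suc q)
  q<i+1+q : q < i ℕ.+ suc q
  q<i+1+q = ℕP.≤-trans (ℕP.n<1+n q) (ℕP.m≤n+m (suc q) i)
  vanish : ∀ a → a < i ℕ.+ suc q → a ≢ q → X (suc a) * g (i ℕ.+ suc q ∸ suc a) ≡ 0ℤ
  vanish a _ a≢q rewrite xPow+1-other (suc q) (suc a) (λ ()) (a≢q ∘ ℕP.suc-injective) = refl

pos-sumℕ : ∀ n (f : ℕ → ℕ) → + sumℕ n f ≡ sumℤ n (λ i → + f i)
pos-sumℕ zero    f = refl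
pos-sumℕ (suc n) f = trans (ℤP.pos-+ (sumℕ n f) (f n)) (cong (_+ + f n) (pos-sumℕ n f))

binomial-theorem : ∀ n (x : ℤ) → (1ℤ + x) ^ n ≡ sumℤ (suc n) (λ i → + (n C i) * x ^ i)
binomial-theorem zero    x = refl
binomial-theorem (suc n) x = begin
  (1ℤ + x) * (1ℤ + x) ^ n                               ≡⟨ cong ((1ℤ + x) *_) (trans (binomial-theorem n x) (sumℤ-head n _)) ⟩
  (1ℤ + x) * (1ℤ + T)                                   ≡⟨ expand x T ⟩
  1ℤ + x * (1ℤ + T) + T                                 ≡⟨ cong₂ (λ a b → 1ℤ + x * a + b) (sym (sumℤ-head n _)) (sym U≡T) ⟩
  1ℤ + x * sumℤ (suc n) (λ i → + (n C i) * x ^ i) + U   ≡⟨ cong (λ a → 1ℤ + a + U) (sym (sumℤ-*ˡ (suc n) x _)) ⟩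
  1ℤ + sumℤ (suc n) (λ i → x * (+ (n C i) * x ^ i)) + U ≡⟨ ℤP.+-assoc 1ℤ (sumℤ (suc n) (λ i → x * (+ (n C i) * x ^ i))) U ⟩
  1ℤ + (sumℤ (suc n) (λ i → x * (+ (n C i) * x ^ i)) + U) ≡⟨ cong (λ a → 1ℤ + a) (sym (sumℤ-distrib-+ (suc n) _ _)) ⟩
  1ℤ + sumℤ (suc n) (λ i → x * (+ (n C i) * x ^ i) + + (n C suc i) * x ^ suc i)
                                                        ≡⟨ cong (λ a → 1ℤ + a) (sumℤ-cong (suc n) (λ i _ → collect i)) ⟩
  1ℤ + sumℤ (suc n) (λ i → + (suc n C suc i) * x ^ suc i) ≡⟨ sym (sumℤ-head (suc n) _) ⟩
  sumℤ (suc (suc n)) (λ i → + (suc n C i) * x ^ i)      ∎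
  where
  open ≡-Reasoning
  T = sumℤ n (λ i → + (n C suc i) * x ^ suc i)
  U = sumℤ (suc n) (λ i → + (n C suc i) * x ^ suc i)
  U≡T : U ≡ T
  U≡T rewrite k>n⇒nCk≡0 {n} {suc n} (ℕP.n<1+n n) | ℤP.*-zeroˡ (x ^ suc n) = ℤP.+-identityʳ T
  expand : ∀ x T → (1ℤ + x) * (1ℤ + T) ≡ 1ℤ + x * (1ℤ + T) + T
  expand = ℤ-Solver.solve-∀
  collect : ∀ i → x * (+ (n C i) * x ^ i) + + (n C suc i) * x ^ suc i ≡ + (suc n C suc i) * x ^ suc i
  collect i rewrite pascal n i | ℤP.pos-+ (n C i) (n C suc i) = factor (+ (n C i)) (+ (n C suc i)) x (x ^ i)
    where
    factor : ∀ a b x y → x * (a * y) + b * (x * y) ≡ (a + b) * (x * y)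
    factor = ℤ-Solver.solve-∀

-- eval d f k is the value at k of a polynomial f whose coefficients vanish from degree d on.
eval : ℕ → Poly → ℤ → ℤ
eval d f k = sumℤ d (λ i → f i * k ^ i)

eval-pad : ∀ d t f k → (∀ i → d ≤ i → f i ≡ 0ℤ) → eval (d ℕ.+ t) f k ≡ eval d f k
eval-pad d t f k f≡0 = begin
  eval (d ℕ.+ t) f k                                       ≡⟨ sumℤ-split d t _ ⟩
  eval d f k + sumℤ t (λ i → f (d ℕ.+ i) * k ^ (d ℕ.+ i))   ≡⟨ cong (λ s → eval d f k + s) (sumℤ-zero t _ vanish) ⟩
  eval d f k + 0ℤ                                          ≡⟨ ℤP.+-identityʳ _ ⟩
  eval d f k                                               ∎
  where
  open ≡-Reasoning
  vanish : ∀ i → i < t → f (d ℕ.+ i) * k ^ (d ℕ.+ i) ≡ 0ℤ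
  vanish i _ rewrite f≡0 (d ℕ.+ i) (ℕP.m≤m+n d i) = ℤP.*-zeroˡ (k ^ (d ℕ.+ i))

eval-xPow+1-· : ∀ {q} → 0 < q → ∀ d f k → (∀ i → d ≤ i → f i ≡ 0ℤ) →
                eval (d ℕ.+ q) (xPow+1 q · f) k ≡ (k ^ q + 1ℤ) * eval d f k
eval-xPow+1-· {q} 0<q d f k f≡0 = begin
  eval (d ℕ.+ q) (X · f) k
    ≡⟨ cong (λ n → eval n (X · f) k) (ℕP.+-comm d q) ⟩
  eval (q ℕ.+ d) (X · f) k
    ≡⟨ sumℤ-split q d _ ⟩
  sumℤ q (λ i → (X · f) i * k ^ i) + sumℤ d (λ i → (X · f) (q ℕ.+ i) * k ^ (q ℕ.+ i))
    ≡⟨ cong₂ _+_ (sumℤ-cong q low) (trans (sumℤ-cong d (λ i _ → high i)) (sumℤ-distrib-+ d _ _)) ⟩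
  eval q f k + (sumℤ d (λ i → f (q ℕ.+ i) * k ^ (q ℕ.+ i)) + sumℤ d (λ i → k ^ q * (f i * k ^ i)))
    ≡⟨ sym (ℤP.+-assoc (eval q f k) _ _) ⟩
  eval q f k + sumℤ d (λ i → f (q ℕ.+ i) * k ^ (q ℕ.+ i)) + sumℤ d (λ i → k ^ q * (f i * k ^ i))
    ≡⟨ cong₂ _+_ (sym (sumℤ-split q d _)) (sumℤ-*ˡ d (k ^ q) _) ⟩
  eval (q ℕ.+ d) f k + k ^ q * eval d f k
    ≡⟨ cong (_+ k ^ q * eval d f k) (trans (cong (λ n → eval n f k) (ℕP.+-comm q d)) (eval-pad d q f k f≡0)) ⟩
  eval d f k + k ^ q * eval d f k
    ≡⟨ factor (eval d f k) (k ^ q) ⟩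
  (k ^ q + 1ℤ) * eval d f k
    ∎
  where
  open ≡-Reasoning
  X = xPow+1 q
  low : ∀ i → i < q → (X · f) i * k ^ i ≡ f i * k ^ i
  low i i<q = cong (_* k ^ i) (xPow+1-·-low 0<q f i i<q)
  high : ∀ i → (X · f) (q ℕ.+ i) * k ^ (q ℕ.+ i) ≡ f (q ℕ.+ i) * k ^ (q ℕ.+ i) + k ^ q * (f i * k ^ i)
  high i rewrite ℕP.+-comm q i | xPow+1-·-high 0<q f i | ℤP.^-distribˡ-+-* k i q = distribute (f (i ℕ.+ q)) (f i) (k ^ i) (k ^ q)
    where
    distribute : ∀ a b u v → (a + b) * (u * v) ≡ a * (u * v) + v * (b * u)
    distribute = ℤ-Solver.solve-∀
  factor : ∀ e v → e + v * e ≡ (v + 1ℤ) * e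
  factor = ℤ-Solver.solve-∀

𝒫-coefficient : ∀ n i → 𝒫 n i ≡ + ((n C i) ℕ.* 𝓛 (n ∸ i))
𝒫-coefficient n i with i ℕ.≤? n
... | yes i≤n = cong (λ c → + (c ℕ.* 𝓛 (n ∸ i))) (sym (nCk≡nC[n∸k] i≤n))
... | no  i≰n = cong (λ c → + (c ℕ.* 𝓛 (n ∸ i))) (sym (k>n⇒nCk≡0 (ℕP.≰⇒> i≰n)))

𝒫-above-degree : ∀ n i → n < i → 𝒫 n i ≡ 0ℤ
𝒫-above-degree n i n<i with i ℕ.≤? n
... | yes i≤n = ⊥-elim (ℕP.<⇒≱ n<i i≤n)
... | no  _   = refl

𝒫-eval≡eval : ∀ n k → 𝒫-eval n k ≡ eval (suc n) (𝒫 n) k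
𝒫-eval≡eval n k = trans (sumℤ-reverse (suc n) _) (sumℤ-cong (suc n) (λ i i<1+n → reindex i (ℕP.≤-pred i<1+n)))
  where
  reindex : ∀ i → i ≤ n → + ((n C (n ∸ i)) ℕ.* 𝓛 (n ∸ i)) * k ^ (n ∸ (n ∸ i)) ≡ 𝒫 n i * k ^ i
  reindex i i≤n = cong₂ _*_ (trans (cong (λ c → + (c ℕ.* 𝓛 (n ∸ i))) (sym (nCk≡nC[n∸k] i≤n))) (sym (𝒫-coefficient n i)))
                            (cong (k ^_) (ℕP.m∸[m∸n]≡n i≤n))

𝒫-zero : ∀ i → 𝒫 0 i ≡ one i
𝒫-zero zero    = refl
𝒫-zero (suc i) = refl

·-identityʳ-𝒫₀ : ∀ f i → (f · 𝒫 0) i ≡ f i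
·-identityʳ-𝒫₀ f i = begin
  (f · 𝒫 0) i   ≡⟨ ·-comm f (𝒫 0) i ⟩
  (𝒫 0 · f) i   ≡⟨ sumℤ-cong (suc i) (λ j _ → cong (_* f (i ∸ j)) (𝒫-zero j)) ⟩
  (one · f) i   ≡⟨ ·-identityˡ f i ⟩
  f i           ∎
  where open ≡-Reasoning

module Congruence (p : ℕ) where

  infix 4 _≈_ _≈ℕ_ _≈ₚ_

  record _≈_ (a b : ℤ) : Set where
    constructor congruent
    field
      p∣a-b : + p Signed.∣ a - b

  ≈-reflexive : ∀ {a b} → a ≡ b → a ≈ b
  ≈-reflexive {a} refl = congruent (Signed.divides 0ℤ (ℤP.+-inverseʳ a))

  ≈-refl : ∀ {a} → a ≈ a
  ≈-refl = ≈-reflexive refl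

  ≈-sym : ∀ {a b} → a ≈ b → b ≈ a
  ≈-sym {a} {b} (congruent a≈b) = congruent (subst (+ p Signed.∣_) (negate a b) (Signed.∣m⇒∣-m a≈b))
    where
    negate : ∀ a b → - (a - b) ≡ b - a
    negate = ℤ-Solver.solve-∀

  ≈-trans : ∀ {a b c} → a ≈ b → b ≈ c → a ≈ c
  ≈-trans {a} {b} {c} (congruent a≈b) (congruent b≈c) =
    congruent (subst (+ p Signed.∣_) (telescope a b c) (Signed.∣m∣n⇒∣m+n a≈b b≈c))
    where
    telescope : ∀ a b c → a - b + (b - c) ≡ a - c
    telescope = ℤ-Solver.solve-∀

  ≈-setoid : Setoid 0ℓ 0ℓ
  ≈-setoid = record { Carrier = ℤ ; _≈_ = _≈_ ; isEquivalence = record { refl = ≈-refl ; sym = ≈-sym ; trans = ≈-trans } }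

  +-cong : ∀ {a b c d} → a ≈ b → c ≈ d → a + c ≈ b + d
  +-cong {a} {b} {c} {d} (congruent a≈b) (congruent c≈d) =
    congruent (subst (+ p Signed.∣_) (regroup a b c d) (Signed.∣m∣n⇒∣m+n a≈b c≈d))
    where
    regroup : ∀ a b c d → a - b + (c - d) ≡ a + c - (b + d)
    regroup = ℤ-Solver.solve-∀

  *-cong : ∀ {a b c d} → a ≈ b → c ≈ d → a * c ≈ b * d
  *-cong {a} {b} {c} {d} (congruent a≈b) (congruent c≈d) =
    congruent (subst (+ p Signed.∣_) (regroup a b c d) (Signed.∣m∣n⇒∣m+n (Signed.∣m⇒∣m*n c a≈b) (Signed.∣n⇒∣m*n b c≈d)))
    where
    regroup : ∀ a b c d → (a - b) * c + b * (c - d) ≡ a * c - b * d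
    regroup = ℤ-Solver.solve-∀

  ^-cong : ∀ {a b} n → a ≈ b → a ^ n ≈ b ^ n
  ^-cong zero    a≈b = ≈-refl
  ^-cong (suc n) a≈b = *-cong a≈b (^-cong n a≈b)

  sumℤ-cong≈ : ∀ n {f g : ℕ → ℤ} → (∀ i → i < n → f i ≈ g i) → sumℤ n f ≈ sumℤ n g
  sumℤ-cong≈ zero    f≈g = ≈-refl
  sumℤ-cong≈ (suc n) f≈g = +-cong (sumℤ-cong≈ n (λ i i<n → f≈g i (ℕP.m<n⇒m<1+n i<n))) (f≈g n (ℕP.n<1+n n))

  ≈-+multiple : ∀ {a b} t → a ≡ b + t * + p → a ≈ b
  ≈-+multiple {b = b} t refl = congruent (Signed.divides t (cancel b t (+ p)))
    where
    cancel : ∀ b t p → b + t * p - b ≡ t * p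
    cancel = ℤ-Solver.solve-∀

  _≈ℕ_ : ℕ → ℕ → Set
  a ≈ℕ b = + a ≈ + b

  ≈ℕ-setoid : Setoid 0ℓ 0ℓ
  ≈ℕ-setoid = record { Carrier = ℕ ; _≈_ = _≈ℕ_ ; isEquivalence = record { refl = ≈-refl ; sym = ≈-sym ; trans = ≈-trans } }

  ≈ℕ-reflexive : ∀ {a b} → a ≡ b → a ≈ℕ b
  ≈ℕ-reflexive refl = ≈-refl

  module ≈-Reasoning = Relation.Binary.Reasoning.Setoid ≈-setoid
  module ≈ℕ-Reasoning = Relation.Binary.Reasoning.Setoid ≈ℕ-setoid

  ≈ℕ-+ : ∀ {a b c d} → a ≈ℕ b → c ≈ℕ d → a ℕ.+ c ≈ℕ b ℕ.+ d
  ≈ℕ-+ {a} {b} {c} {d} a≈b c≈d rewrite ℤP.pos-+ a c | ℤP.pos-+ b d = +-cong a≈b c≈d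

  ≈ℕ-* : ∀ {a b c d} → a ≈ℕ b → c ≈ℕ d → a ℕ.* c ≈ℕ b ℕ.* d
  ≈ℕ-* {a} {b} {c} {d} a≈b c≈d rewrite ℤP.pos-* a c | ℤP.pos-* b d = *-cong a≈b c≈d

  ∣⇒≈ℕ0 : ∀ {n} → p ℕD.∣ n → n ≈ℕ 0
  ∣⇒≈ℕ0 (ℕD.divides t refl) = ≈-+multiple (+ t) (trans (ℤP.pos-* t p) (sym (ℤP.+-identityˡ (+ t * + p))))

  +p≈ℕ : ∀ a → a ℕ.+ p ≈ℕ a
  +p≈ℕ a = ≈-+multiple 1ℤ (trans (ℤP.pos-+ a p) (cong (λ x → + a + x) (sym (ℤP.*-identityˡ (+ p)))))

  _≈ₚ_ : Poly → Poly → Set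
  f ≈ₚ g = ∀ i → f i ≈ g i

  ≈ₚ-setoid : Setoid 0ℓ 0ℓ
  ≈ₚ-setoid = record
    { Carrier = Poly
    ; _≈_ = _≈ₚ_
    ; isEquivalence = record
      { refl = λ _ → ≈-refl ; sym = λ f≈g i → ≈-sym (f≈g i) ; trans = λ f≈g g≈h i → ≈-trans (f≈g i) (g≈h i) }
    }

  module ≈ₚ-Reasoning = Relation.Binary.Reasoning.Setoid ≈ₚ-setoid

  ≗⇒≈ₚ : ∀ {f g : Poly} → (∀ i → f i ≡ g i) → f ≈ₚ g
  ≗⇒≈ₚ f≗g i = ≈-reflexive (f≗g i)

  ·-congˡ : ∀ {f f′} g → f ≈ₚ f′ → f · g ≈ₚ f′ · g
  ·-congˡ g f≈f′ n = sumℤ-cong≈ (suc n) (λ i _ → *-cong (f≈f′ i) ≈-refl)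

  ·-congʳ : ∀ f {g g′} → g ≈ₚ g′ → f · g ≈ₚ f · g′
  ·-congʳ f g≈g′ n = sumℤ-cong≈ (suc n) (λ i _ → *-cong (≈-refl {f i}) (g≈g′ (n ∸ i)))

  ≈⇒∣ : ∀ {a b} → a ≈ b → + p ℤD.∣ a - b
  ≈⇒∣ (congruent p∣a-b) = Signed.∣⇒∣ᵤ p∣a-b

  ≈ₚ⇒≡ₚ : ∀ {f g} → f ≈ₚ g → f ≡ₚ g [mod p ]
  ≈ₚ⇒≡ₚ f≈g i = ≈⇒∣ (f≈g i)

  InnerBinomialsVanish : ℕ → Set
  InnerBinomialsVanish q = ∀ k → 0 < k → k < q → q C k ≈ℕ 0

  -- Coefficients of (1+x)^(n+q) ≡ (1+x)^n (1+x^q) below and from degree q.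
  C-shift-low : ∀ {q} → InnerBinomialsVanish q → ∀ n k → k < q → (n ℕ.+ q) C k ≈ℕ n C k
  C-shift-low vanish zero    zero    _   = ≈-refl
  C-shift-low vanish zero    (suc k) k<q = vanish (suc k) (s≤s z≤n) k<q
  C-shift-low vanish (suc n) zero    _   = ≈-refl
  C-shift-low {q} vanish (suc n) (suc k) k<q = begin
    suc (n ℕ.+ q) C suc k                 ≡⟨ pascal (n ℕ.+ q) k ⟩
    (n ℕ.+ q) C k ℕ.+ (n ℕ.+ q) C suc k   ≈⟨ ≈ℕ-+ (C-shift-low vanish n k (ℕP.<-trans (ℕP.n<1+n k) k<q))
                                                   (C-shift-low vanish n (suc k) k<q) ⟩
    n C k ℕ.+ n C suc k                   ≡⟨ pascal n k ⟨
    suc n C suc k                         ∎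
    where open ≈ℕ-Reasoning

  C-shift-high : ∀ {q} → 0 < q → InnerBinomialsVanish q → ∀ n k → (n ℕ.+ q) C (k ℕ.+ q) ≈ℕ n C (k ℕ.+ q) ℕ.+ n C k
  C-shift-high {suc q₀} _ vanish zero zero    = ≈ℕ-reflexive (nCn≡1 (suc q₀))
  C-shift-high {suc q₀} _ vanish zero (suc k) = ≈ℕ-reflexive (k>n⇒nCk≡0 {suc q₀} {suc k ℕ.+ suc q₀} (ℕP.m<n+m (suc q₀) (s≤s z≤n)))
  C-shift-high {suc q₀} 0<q vanish (suc n) zero = begin
    suc (n ℕ.+ q) C suc q₀                        ≡⟨ pascal (n ℕ.+ q) q₀ ⟩
    (n ℕ.+ q) C q₀ ℕ.+ (n ℕ.+ q) C q              ≈⟨ ≈ℕ-+ (C-shift-low vanish n q₀ (ℕP.n<1+n q₀)) (C-shift-high 0<q vanish n zero) ⟩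
    n C q₀ ℕ.+ (n C q ℕ.+ 1)                      ≡⟨ ℕP.+-assoc (n C q₀) (n C q) 1 ⟨
    n C q₀ ℕ.+ n C q ℕ.+ 1                        ≡⟨ cong (ℕ._+ 1) (pascal n q₀) ⟨
    suc n C q ℕ.+ 1                               ∎
    where
    open ≈ℕ-Reasoning
    q = suc q₀
  C-shift-high {q} 0<q vanish (suc n) (suc k) = begin
    suc (n ℕ.+ q) C suc (k ℕ.+ q)
      ≡⟨ pascal (n ℕ.+ q) (k ℕ.+ q) ⟩
    (n ℕ.+ q) C (k ℕ.+ q) ℕ.+ (n ℕ.+ q) C suc (k ℕ.+ q)
      ≈⟨ ≈ℕ-+ (C-shift-high 0<q vanish n k) (C-shift-high 0<q vanish n (suc k)) ⟩
    (n C (k ℕ.+ q) ℕ.+ n C k) ℕ.+ (n C suc (k ℕ.+ q) ℕ.+ n C suc k)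
      ≡⟨ interchange (n C (k ℕ.+ q)) (n C k) (n C suc (k ℕ.+ q)) (n C suc k) ⟩
    (n C (k ℕ.+ q) ℕ.+ n C suc (k ℕ.+ q)) ℕ.+ (n C k ℕ.+ n C suc k)
      ≡⟨ cong₂ ℕ._+_ (pascal n (k ℕ.+ q)) (pascal n k) ⟨
    suc n C suc (k ℕ.+ q) ℕ.+ suc n C suc k
      ∎
    where
    open ≈ℕ-Reasoning
    interchange : ∀ a b c d → (a ℕ.+ b) ℕ.+ (c ℕ.+ d) ≡ (a ℕ.+ c) ℕ.+ (b ℕ.+ d)
    interchange = ℕ-Solver.solve-∀

  freshmans-dream : ∀ {q} → 0 < q → InnerBinomialsVanish q → ∀ a → (1ℤ + a) ^ q ≈ 1ℤ + a ^ q
  freshmans-dream {suc q₀} _ vanish a = begin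
    (1ℤ + a) ^ suc q₀
      ≡⟨ trans (binomial-theorem (suc q₀) a) (sumℤ-head (suc q₀) term) ⟩
    1ℤ + (sumℤ q₀ (λ i → term (suc i)) + term (suc q₀))
      ≈⟨ +-cong (≈-refl {1ℤ}) (+-cong (sumℤ-cong≈ q₀ inner≈0) (≈-refl {term (suc q₀)})) ⟩
    1ℤ + (sumℤ q₀ (λ _ → 0ℤ) + term (suc q₀))
      ≡⟨ cong (λ s → 1ℤ + (s + term (suc q₀))) (sumℤ-zero q₀ _ (λ _ _ → refl)) ⟩
    1ℤ + (0ℤ + term (suc q₀))
      ≡⟨ cong (λ c → 1ℤ + c) (trans (ℤP.+-identityˡ _) top-term) ⟩
    1ℤ + a ^ suc q₀
      ∎
    where
    open ≈-Reasoning
    term : ℕ → ℤ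
    term i = + (suc q₀ C i) * a ^ i
    inner≈0 : ∀ i → i < q₀ → term (suc i) ≈ 0ℤ
    inner≈0 i i<q₀ = ≈-trans (*-cong (vanish (suc i) (s≤s z≤n) (s≤s i<q₀)) (≈-refl {a ^ suc i}))
                             (≈-reflexive (ℤP.*-zeroˡ (a ^ suc i)))
    top-term : term (suc q₀) ≡ a ^ suc q₀
    top-term rewrite nCn≡1 (suc q₀) = ℤP.*-identityˡ (a ^ suc q₀)

  eval-cong : ∀ d {f g} k → f ≈ₚ g → eval d f k ≈ eval d g k
  eval-cong d k f≈g = sumℤ-cong≈ d (λ i _ → *-cong (f≈g i) (≈-refl {k ^ i}))

  module Shift {q} (0<q : 0 < q) (vanish : InnerBinomialsVanish q) (𝓛-periodic : ∀ m → 𝓛 (m ℕ.+ q) ≈ℕ 𝓛 m) where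

    X : Poly
    X = xPow+1 q

    C*𝓛-shift : ∀ n i a b → (i ≤ n → a ≡ b ℕ.+ q) → (n C i) ℕ.* 𝓛 a ≈ℕ (n C i) ℕ.* 𝓛 b
    C*𝓛-shift n i a b a≡b+q with i ℕ.≤? n
    ... | yes i≤n rewrite a≡b+q i≤n = ≈ℕ-* (≈-refl {+ (n C i)}) (𝓛-periodic b)
    ... | no  i≰n rewrite k>n⇒nCk≡0 {n} {i} (ℕP.≰⇒> i≰n) = ≈-refl

    𝒫-shift : ∀ n → 𝒫 (n ℕ.+ q) ≈ₚ X · 𝒫 n
    𝒫-shift n i with i ℕ.<? q
    ... | yes i<q = begin
      𝒫 (n ℕ.+ q) i                              ≡⟨ 𝒫-coefficient (n ℕ.+ q) i ⟩
      + (((n ℕ.+ q) C i) ℕ.* 𝓛 (n ℕ.+ q ∸ i))     ≈⟨ ≈ℕ-* (C-shift-low vanish n i i<q) (≈-refl {+ 𝓛 (n ℕ.+ q ∸ i)}) ⟩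
      + ((n C i) ℕ.* 𝓛 (n ℕ.+ q ∸ i))             ≈⟨ C*𝓛-shift n i _ _ (ℕP.+-∸-comm q) ⟩
      + ((n C i) ℕ.* 𝓛 (n ∸ i))                   ≡⟨ 𝒫-coefficient n i ⟨
      𝒫 n i                                       ≡⟨ xPow+1-·-low 0<q (𝒫 n) i i<q ⟨
      (X · 𝒫 n) i                                 ∎
      where open ≈-Reasoning
    ... | no i≮q = subst (λ i → 𝒫 (n ℕ.+ q) i ≈ (X · 𝒫 n) i) (ℕP.m∸n+n≡m (ℕP.≮⇒≥ i≮q)) (high (i ∸ q))
      where
      open ≈-Reasoning
      drop-q : ∀ j → j ℕ.+ q ≤ n → n ∸ j ≡ n ∸ (j ℕ.+ q) ℕ.+ q
      drop-q j j+q≤n = trans (sym (ℕP.m∸n+n≡m (ℕP.m+n≤o⇒m≤o∸n q (subst (_≤ n) (ℕP.+-comm j q) j+q≤n))))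
                             (cong (ℕ._+ q) (ℕP.∸-+-assoc n j q))
      cancel-q : ∀ j → n ℕ.+ q ∸ (j ℕ.+ q) ≡ n ∸ j
      cancel-q j = trans (cong₂ _∸_ (ℕP.+-comm n q) (ℕP.+-comm j q)) (ℕP.[m+n]∸[m+o]≡n∸o q n j)
      high : ∀ j → 𝒫 (n ℕ.+ q) (j ℕ.+ q) ≈ (X · 𝒫 n) (j ℕ.+ q)
      high j = begin
        𝒫 (n ℕ.+ q) (j ℕ.+ q)
          ≡⟨ 𝒫-coefficient (n ℕ.+ q) (j ℕ.+ q) ⟩
        + (((n ℕ.+ q) C (j ℕ.+ q)) ℕ.* 𝓛 (n ℕ.+ q ∸ (j ℕ.+ q)))
          ≡⟨ cong (λ m → + (((n ℕ.+ q) C (j ℕ.+ q)) ℕ.* 𝓛 m)) (cancel-q j) ⟩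
        + (((n ℕ.+ q) C (j ℕ.+ q)) ℕ.* 𝓛 (n ∸ j))
          ≈⟨ ≈ℕ-* (C-shift-high 0<q vanish n j) (≈-refl {+ 𝓛 (n ∸ j)}) ⟩
        + ((n C (j ℕ.+ q) ℕ.+ n C j) ℕ.* 𝓛 (n ∸ j))
          ≡⟨ cong +_ (ℕP.*-distribʳ-+ (𝓛 (n ∸ j)) (n C (j ℕ.+ q)) (n C j)) ⟩
        + ((n C (j ℕ.+ q)) ℕ.* 𝓛 (n ∸ j) ℕ.+ (n C j) ℕ.* 𝓛 (n ∸ j))
          ≈⟨ ≈ℕ-+ (C*𝓛-shift n (j ℕ.+ q) _ _ (drop-q j)) (≈-refl {+ ((n C j) ℕ.* 𝓛 (n ∸ j))}) ⟩
        + ((n C (j ℕ.+ q)) ℕ.* 𝓛 (n ∸ (j ℕ.+ q)) ℕ.+ (n C j) ℕ.* 𝓛 (n ∸ j))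
          ≡⟨ ℤP.pos-+ ((n C (j ℕ.+ q)) ℕ.* 𝓛 (n ∸ (j ℕ.+ q))) ((n C j) ℕ.* 𝓛 (n ∸ j)) ⟩
        + ((n C (j ℕ.+ q)) ℕ.* 𝓛 (n ∸ (j ℕ.+ q))) + + ((n C j) ℕ.* 𝓛 (n ∸ j))
          ≡⟨ cong₂ _+_ (𝒫-coefficient n (j ℕ.+ q)) (𝒫-coefficient n j) ⟨
        𝒫 n (j ℕ.+ q) + 𝒫 n j
          ≡⟨ xPow+1-·-high 0<q (𝒫 n) j ⟨
        (X · 𝒫 n) (j ℕ.+ q)
          ∎

    +-suc-multiple : ∀ n c → n ℕ.+ suc c ℕ.* q ≡ n ℕ.+ c ℕ.* q ℕ.+ q
    +-suc-multiple n c = trans (cong (n ℕ.+_) (ℕP.+-comm q (c ℕ.* q))) (sym (ℕP.+-assoc n (c ℕ.* q) q))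

    𝒫-shift-multiple : ∀ c n → 𝒫 (n ℕ.+ c ℕ.* q) ≈ₚ (X ^^ c) · 𝒫 n
    𝒫-shift-multiple zero    n = ≗⇒≈ₚ (λ i → trans (cong (λ m → 𝒫 m i) (ℕP.+-identityʳ n)) (sym (·-identityˡ (𝒫 n) i)))
    𝒫-shift-multiple (suc c) n = begin
      𝒫 (n ℕ.+ suc c ℕ.* q)        ≡⟨ cong 𝒫 (+-suc-multiple n c) ⟩
      𝒫 (n ℕ.+ c ℕ.* q ℕ.+ q)      ≈⟨ 𝒫-shift (n ℕ.+ c ℕ.* q) ⟩
      X · 𝒫 (n ℕ.+ c ℕ.* q)        ≈⟨ ·-congʳ X (𝒫-shift-multiple c n) ⟩
      X · ((X ^^ c) · 𝒫 n)         ≈⟨ ≗⇒≈ₚ (λ i → sym (·-assoc X (X ^^ c) (𝒫 n) i)) ⟩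
      (X · (X ^^ c)) · 𝒫 n         ∎
      where open ≈ₚ-Reasoning

    module _ (fermat : ∀ k → k ^ q ≈ k) where

      eval-𝒫-shift : ∀ k n → eval (suc (n ℕ.+ q)) (𝒫 (n ℕ.+ q)) k ≈ (k + 1ℤ) * eval (suc n) (𝒫 n) k
      eval-𝒫-shift k n = begin
        eval (suc n ℕ.+ q) (𝒫 (n ℕ.+ q)) k     ≈⟨ eval-cong (suc n ℕ.+ q) k (𝒫-shift n) ⟩
        eval (suc n ℕ.+ q) (X · 𝒫 n) k         ≡⟨ eval-xPow+1-· 0<q (suc n) (𝒫 n) k (𝒫-above-degree n) ⟩
        (k ^ q + 1ℤ) * eval (suc n) (𝒫 n) k    ≈⟨ *-cong (+-cong (fermat k) (≈-refl {1ℤ})) (≈-refl {eval (suc n) (𝒫 n) k}) ⟩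
        (k + 1ℤ) * eval (suc n) (𝒫 n) k        ∎
        where open ≈-Reasoning

      eval-𝒫-shift-multiple : ∀ k c n →
        eval (suc (n ℕ.+ c ℕ.* q)) (𝒫 (n ℕ.+ c ℕ.* q)) k ≈ (k + 1ℤ) ^ c * eval (suc n) (𝒫 n) k
      eval-𝒫-shift-multiple k zero    n = ≈-reflexive (trans (cong (λ m → eval (suc m) (𝒫 m) k) (ℕP.+-identityʳ n))
                                                              (sym (ℤP.*-identityˡ _)))
      eval-𝒫-shift-multiple k (suc c) n = begin
        eval (suc (n ℕ.+ suc c ℕ.* q)) (𝒫 (n ℕ.+ suc c ℕ.* q)) k
          ≡⟨ cong (λ m → eval (suc m) (𝒫 m) k) (+-suc-multiple n c) ⟩
        eval (suc (n ℕ.+ c ℕ.* q ℕ.+ q)) (𝒫 (n ℕ.+ c ℕ.* q ℕ.+ q)) k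
          ≈⟨ eval-𝒫-shift k (n ℕ.+ c ℕ.* q) ⟩
        (k + 1ℤ) * eval (suc (n ℕ.+ c ℕ.* q)) (𝒫 (n ℕ.+ c ℕ.* q)) k
          ≈⟨ *-cong (≈-refl {k + 1ℤ}) (eval-𝒫-shift-multiple k c n) ⟩
        (k + 1ℤ) * ((k + 1ℤ) ^ c * eval (suc n) (𝒫 n) k)
          ≡⟨ ℤP.*-assoc (k + 1ℤ) _ _ ⟨
        (k + 1ℤ) ^ suc c * eval (suc n) (𝒫 n) k
          ∎
        where open ≈-Reasoning

module ModPrime (p₁ : ℕ) (p-prime : Prime (suc p₁)) where

  p : ℕ
  p = suc p₁

  open Congruence p public

  0<p : 0 < p
  0<p = s≤s z≤n

  1<p : 1 < p
  1<p = ℕ.nonTrivial⇒n>1 p {{prime⇒nonTrivial p-prime}}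

  p∣pCk : ∀ {k} → 0 < k → k < p → p ℕD.∣ p C k
  p∣pCk {suc k} _ k<p with euclidsLemma (suc k) (p C suc k) p-prime
                             (subst (p ℕD.∣_) (sym (absorption p₁ k)) (ℕD.m∣m*n (p₁ C k)))
  ... | inj₁ p∣1+k = ⊥-elim (ℕP.<⇒≱ k<p (ℕD.∣⇒≤ p∣1+k))
  ... | inj₂ p∣pCk = p∣pCk

  p-vanish : InnerBinomialsVanish p
  p-vanish k 0<k k<p = ∣⇒≈ℕ0 (p∣pCk 0<k k<p)

  p∤k! : ∀ k → k < p → ¬ (p ℕD.∣ k !)
  p∤k! zero    _   p∣1 = ℕP.<⇒≱ 1<p (ℕD.∣⇒≤ p∣1)
  p∤k! (suc k) k<p p∣k! with euclidsLemma (suc k) (k !) p-prime p∣k!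
  ... | inj₁ p∣1+k = ℕP.<⇒≱ k<p (ℕD.∣⇒≤ p∣1+k)
  ... | inj₂ p∣k!′ = p∤k! k (ℕP.<-trans (ℕP.n<1+n k) k<p) p∣k!′

  p∣Lah : ∀ {k} → 0 < k → k < p → p ℕD.∣ Lah p k
  p∣Lah {suc k} _ k<p with euclidsLemma (suc k !) (Lah p (suc k)) p-prime p∣k!Lah
    where
    p∣k!Lah : p ℕD.∣ suc k ! ℕ.* Lah p (suc k)
    p∣k!Lah = subst (p ℕD.∣_) (sym (trans (Lah-closed-form p₁ k) (ℕP.*-assoc p (p₁ !) (p₁ C k))))
                              (ℕD.m∣m*n (p₁ ! ℕ.* (p₁ C k)))
  ... | inj₁ p∣k! = ⊥-elim (p∤k! (suc k) k<p p∣k!)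
  ... | inj₂ p∣L  = p∣L

  +p+p≈ℕ : ∀ a → a ℕ.+ p ℕ.+ p ≈ℕ a
  +p+p≈ℕ a = ≈-trans (+p≈ℕ (a ℕ.+ p)) (+p≈ℕ a)

  Lah-+p-below : ∀ n k → k < p → Lah (n ℕ.+ p) k ≈ℕ 0
  Lah-+p-below zero    zero    _   = ≈-refl
  Lah-+p-below zero    (suc k) k<p = ∣⇒≈ℕ0 (p∣Lah (s≤s z≤n) k<p)
  Lah-+p-below (suc n) zero    _   = ≈-refl
  Lah-+p-below (suc n) (suc k) k<p = begin
    (n ℕ.+ p ℕ.+ suc k) ℕ.* Lah (n ℕ.+ p) (suc k) ℕ.+ Lah (n ℕ.+ p) k
      ≈⟨ ≈ℕ-+ (≈ℕ-* (≈-refl {+ (n ℕ.+ p ℕ.+ suc k)}) (Lah-+p-below n (suc k) k<p))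
              (Lah-+p-below n k (ℕP.<-trans (ℕP.n<1+n k) k<p)) ⟩
    (n ℕ.+ p ℕ.+ suc k) ℕ.* 0 ℕ.+ 0
      ≡⟨ cong (ℕ._+ 0) (ℕP.*-zeroʳ (n ℕ.+ p ℕ.+ suc k)) ⟩
    0 ∎
    where open ≈ℕ-Reasoning

  Lah-+p-+p : ∀ n k → Lah (n ℕ.+ p) (k ℕ.+ p) ≈ℕ Lah n k
  Lah-+p-+p zero    zero    = ≈ℕ-reflexive (Lah-diagonal p)
  Lah-+p-+p zero    (suc k) = ≈ℕ-reflexive (Lah-above-diagonal (ℕP.m<n+m p {suc k} (s≤s z≤n)))
  Lah-+p-+p (suc n) zero    = begin
    (n ℕ.+ p ℕ.+ p) ℕ.* Lah (n ℕ.+ p) p ℕ.+ Lah (n ℕ.+ p) p₁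
      ≈⟨ ≈ℕ-+ (≈ℕ-* (+p+p≈ℕ n) (Lah-+p-+p n zero)) (Lah-+p-below n p₁ (ℕP.n<1+n p₁)) ⟩
    n ℕ.* Lah n 0 ℕ.+ 0
      ≡⟨ trans (ℕP.+-identityʳ _) (*-Lah-zero n) ⟩
    0 ∎
    where open ≈ℕ-Reasoning
  Lah-+p-+p (suc n) (suc k) = begin
    (n ℕ.+ p ℕ.+ suc (k ℕ.+ p)) ℕ.* Lah (n ℕ.+ p) (suc k ℕ.+ p) ℕ.+ Lah (n ℕ.+ p) (k ℕ.+ p)
      ≈⟨ ≈ℕ-+ (≈ℕ-* coefficient (Lah-+p-+p n (suc k))) (Lah-+p-+p n k) ⟩
    (n ℕ.+ suc k) ℕ.* Lah n (suc k) ℕ.+ Lah n k ∎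
    where
    open ≈ℕ-Reasoning
    regroup : ∀ n k p → n ℕ.+ p ℕ.+ suc (k ℕ.+ p) ≡ n ℕ.+ suc k ℕ.+ p ℕ.+ p
    regroup = ℕ-Solver.solve-∀
    coefficient : n ℕ.+ p ℕ.+ suc (k ℕ.+ p) ≈ℕ n ℕ.+ suc k
    coefficient = ≈-trans (≈ℕ-reflexive (regroup n k p)) (+p+p≈ℕ (n ℕ.+ suc k))

  𝓛-+p : ∀ n → 𝓛 (n ℕ.+ p) ≈ℕ 𝓛 n
  𝓛-+p n = begin
    + 𝓛 (n ℕ.+ p)                                         ≡⟨ pos-sumℕ (suc (n ℕ.+ p)) (Lah (n ℕ.+ p)) ⟩
    sumℤ (suc (n ℕ.+ p)) (λ k → + Lah (n ℕ.+ p) k)         ≡⟨ cong (λ l → sumℤ l (λ k → + Lah (n ℕ.+ p) k)) length ⟩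
    sumℤ (p ℕ.+ suc n) (λ k → + Lah (n ℕ.+ p) k)           ≡⟨ sumℤ-split p (suc n) _ ⟩
    sumℤ p (λ k → + Lah (n ℕ.+ p) k) + sumℤ (suc n) (λ k → + Lah (n ℕ.+ p) (p ℕ.+ k))
      ≈⟨ +-cong (sumℤ-cong≈ p (Lah-+p-below n)) (sumℤ-cong≈ (suc n) (λ k _ → shifted k)) ⟩
    sumℤ p (λ _ → 0ℤ) + sumℤ (suc n) (λ k → + Lah n k)     ≡⟨ cong (_+ sumℤ (suc n) (λ k → + Lah n k)) (sumℤ-zero p _ (λ _ _ → refl)) ⟩
    0ℤ + sumℤ (suc n) (λ k → + Lah n k)                   ≡⟨ ℤP.+-identityˡ _ ⟩
    sumℤ (suc n) (λ k → + Lah n k)                        ≡⟨ pos-sumℕ (suc n) (Lah n) ⟨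
    + 𝓛 n                                                 ∎
    where
    open ≈-Reasoning
    length : suc (n ℕ.+ p) ≡ p ℕ.+ suc n
    length = trans (cong suc (ℕP.+-comm n p)) (sym (ℕP.+-suc p n))
    shifted : ∀ k → Lah (n ℕ.+ p) (p ℕ.+ k) ≈ℕ Lah n k
    shifted k = ≈-trans (≈ℕ-reflexive (cong (Lah (n ℕ.+ p)) (ℕP.+-comm p k))) (Lah-+p-+p n k)

  𝓛-+multiple : ∀ c n → 𝓛 (n ℕ.+ c ℕ.* p) ≈ℕ 𝓛 n
  𝓛-+multiple zero    n = ≈ℕ-reflexive (cong 𝓛 (ℕP.+-identityʳ n))
  𝓛-+multiple (suc c) n = begin
    𝓛 (n ℕ.+ (p ℕ.+ c ℕ.* p))   ≡⟨ cong 𝓛 (trans (cong (n ℕ.+_) (ℕP.+-comm p (c ℕ.* p))) (sym (ℕP.+-assoc n (c ℕ.* p) p))) ⟩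
    𝓛 (n ℕ.+ c ℕ.* p ℕ.+ p)     ≈⟨ 𝓛-+p (n ℕ.+ c ℕ.* p) ⟩
    𝓛 (n ℕ.+ c ℕ.* p)           ≈⟨ 𝓛-+multiple c n ⟩
    𝓛 n                         ∎
    where open ≈ℕ-Reasoning

  𝓛-+prime-power : ∀ j n → 𝓛 (n ℕ.+ p ℕ.^ suc j) ≈ℕ 𝓛 n
  𝓛-+prime-power j n = ≈-trans (≈ℕ-reflexive (cong (λ q → 𝓛 (n ℕ.+ q)) (ℕP.*-comm p (p ℕ.^ j)))) (𝓛-+multiple (p ℕ.^ j) n)

  C-multiple-multiple+r : ∀ {r} → 0 < r → r < p → ∀ a b → (a ℕ.* p) C (b ℕ.* p ℕ.+ r) ≈ℕ 0
  C-multiple-multiple+r {r} 0<r r<p zero b =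
    ≈ℕ-reflexive (k>n⇒nCk≡0 {0} {b ℕ.* p ℕ.+ r} (ℕP.≤-trans 0<r (ℕP.m≤n+m r (b ℕ.* p))))
  C-multiple-multiple+r {r} 0<r r<p (suc a) zero = begin
    (p ℕ.+ a ℕ.* p) C r   ≡⟨ cong (_C r) (ℕP.+-comm p (a ℕ.* p)) ⟩
    (a ℕ.* p ℕ.+ p) C r   ≈⟨ C-shift-low p-vanish (a ℕ.* p) r r<p ⟩
    (a ℕ.* p) C r         ≈⟨ C-multiple-multiple+r 0<r r<p a zero ⟩
    0                     ∎
    where open ≈ℕ-Reasoning
  C-multiple-multiple+r {r} 0<r r<p (suc a) (suc b) = begin
    (p ℕ.+ a ℕ.* p) C (p ℕ.+ b ℕ.* p ℕ.+ r)
      ≡⟨ cong₂ _C_ (ℕP.+-comm p (a ℕ.* p)) (shuffle p (b ℕ.* p) r) ⟩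
    (a ℕ.* p ℕ.+ p) C (b ℕ.* p ℕ.+ r ℕ.+ p)
      ≈⟨ C-shift-high 0<p p-vanish (a ℕ.* p) (b ℕ.* p ℕ.+ r) ⟩
    (a ℕ.* p) C (b ℕ.* p ℕ.+ r ℕ.+ p) ℕ.+ (a ℕ.* p) C (b ℕ.* p ℕ.+ r)
      ≡⟨ cong (λ k → (a ℕ.* p) C k ℕ.+ (a ℕ.* p) C (b ℕ.* p ℕ.+ r)) (shuffle p (b ℕ.* p) r) ⟨
    (a ℕ.* p) C (suc b ℕ.* p ℕ.+ r) ℕ.+ (a ℕ.* p) C (b ℕ.* p ℕ.+ r)
      ≈⟨ ≈ℕ-+ (C-multiple-multiple+r 0<r r<p a (suc b)) (C-multiple-multiple+r 0<r r<p a b) ⟩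
    0
      ∎
    where
    open ≈ℕ-Reasoning
    shuffle : ∀ p m r → p ℕ.+ m ℕ.+ r ≡ m ℕ.+ r ℕ.+ p
    shuffle = ℕ-Solver.solve-∀

  C-multiple-multiple : ∀ a b → (a ℕ.* p) C (b ℕ.* p) ≈ℕ a C b
  C-multiple-multiple zero    zero    = ≈-refl
  C-multiple-multiple zero    (suc b) = ≈-refl
  C-multiple-multiple (suc a) zero    = ≈-refl
  C-multiple-multiple (suc a) (suc b) = begin
    (p ℕ.+ a ℕ.* p) C (p ℕ.+ b ℕ.* p)
      ≡⟨ cong₂ _C_ (ℕP.+-comm p (a ℕ.* p)) (ℕP.+-comm p (b ℕ.* p)) ⟩
    (a ℕ.* p ℕ.+ p) C (b ℕ.* p ℕ.+ p)
      ≈⟨ C-shift-high 0<p p-vanish (a ℕ.* p) (b ℕ.* p) ⟩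
    (a ℕ.* p) C (b ℕ.* p ℕ.+ p) ℕ.+ (a ℕ.* p) C (b ℕ.* p)
      ≡⟨ cong (λ k → (a ℕ.* p) C k ℕ.+ (a ℕ.* p) C (b ℕ.* p)) (ℕP.+-comm (b ℕ.* p) p) ⟩
    (a ℕ.* p) C (suc b ℕ.* p) ℕ.+ (a ℕ.* p) C (b ℕ.* p)
      ≈⟨ ≈ℕ-+ (C-multiple-multiple a (suc b)) (C-multiple-multiple a b) ⟩
    a C suc b ℕ.+ a C b
      ≡⟨ trans (ℕP.+-comm (a C suc b) (a C b)) (sym (pascal a b)) ⟩
    suc a C suc b
      ∎
    where open ≈ℕ-Reasoning

  prime-power-vanish : ∀ j → InnerBinomialsVanish (p ℕ.^ j)
  prime-power-vanish zero    k 0<k k<1 = ⊥-elim (ℕP.<⇒≱ 0<k (ℕP.≤-pred k<1))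
  prime-power-vanish (suc j) k 0<k k<p^[1+j] with k ℕDM.% p ℕ.≟ 0
  ... | no r≢0 = begin
    (p ℕ.* p ℕ.^ j) C k                      ≡⟨ cong₂ _C_ (ℕP.*-comm p (p ℕ.^ j)) k≡b*p+r ⟩
    (p ℕ.^ j ℕ.* p) C (k ℕDM./ p ℕ.* p ℕ.+ k ℕDM.% p)
      ≈⟨ C-multiple-multiple+r (ℕP.n≢0⇒n>0 r≢0) (ℕDM.m%n<n k p) (p ℕ.^ j) (k ℕDM./ p) ⟩
    0                                        ∎
    where
    open ≈ℕ-Reasoning
    k≡b*p+r : k ≡ k ℕDM./ p ℕ.* p ℕ.+ k ℕDM.% p
    k≡b*p+r = trans (ℕDM.m≡m%n+[m/n]*n k p) (ℕP.+-comm (k ℕDM.% p) _)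
  ... | yes r≡0 = begin
    (p ℕ.* p ℕ.^ j) C k                      ≡⟨ cong₂ _C_ (ℕP.*-comm p (p ℕ.^ j)) k≡b*p ⟩
    (p ℕ.^ j ℕ.* p) C (b ℕ.* p)              ≈⟨ C-multiple-multiple (p ℕ.^ j) b ⟩
    (p ℕ.^ j) C b                            ≈⟨ prime-power-vanish j b 0<b b<p^j ⟩
    0                                        ∎
    where
    open ≈ℕ-Reasoning
    b = k ℕDM./ p
    k≡b*p : k ≡ b ℕ.* p
    k≡b*p = trans (ℕDM.m≡m%n+[m/n]*n k p) (cong (ℕ._+ b ℕ.* p) r≡0)
    0<b : 0 < b
    0<b = ℕP.n≢0⇒n>0 (λ b≡0 → ℕP.<⇒≢ 0<k (sym (trans k≡b*p (cong (ℕ._* p) b≡0))))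
    b<p^j : b < p ℕ.^ j
    b<p^j = ℕP.*-cancelʳ-< p b (p ℕ.^ j) (subst₂ _<_ k≡b*p (ℕP.*-comm p (p ℕ.^ j)) k<p^[1+j])

  fermat-ℕ : ∀ a → (+ a) ^ p ≈ + a
  fermat-ℕ zero    = ≈-reflexive (ℤP.*-zeroˡ ((+ 0) ^ p₁))
  fermat-ℕ (suc a) = begin
    (+ suc a) ^ p      ≡⟨ cong (_^ p) (ℤP.pos-+ 1 a) ⟩
    (1ℤ + + a) ^ p     ≈⟨ freshmans-dream 0<p p-vanish (+ a) ⟩
    1ℤ + (+ a) ^ p     ≈⟨ +-cong (≈-refl {1ℤ}) (fermat-ℕ a) ⟩
    1ℤ + + a           ≡⟨ ℤP.pos-+ 1 a ⟨
    + suc a            ∎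
    where open ≈-Reasoning

  fermat : ∀ k → k ^ p ≈ k
  fermat k = begin
    k ^ p       ≈⟨ ^-cong p k≈r ⟩
    (+ r) ^ p   ≈⟨ fermat-ℕ r ⟩
    + r         ≈⟨ k≈r ⟨
    k           ∎
    where
    open ≈-Reasoning
    r = k ℤDM.%ℕ p
    k≈r : k ≈ + r
    k≈r = ≈-+multiple (k ℤDM./ℕ p) (ℤDM.a≡a%ℕn+[a/ℕn]*n k p)

  fermat-power : ∀ j k → k ^ (p ℕ.^ j) ≈ k
  fermat-power zero    k = ≈-reflexive (ℤP.*-identityʳ k)
  fermat-power (suc j) k = begin
    k ^ (p ℕ.* p ℕ.^ j)     ≡⟨ trans (cong (k ^_) (ℕP.*-comm p (p ℕ.^ j))) (sym (ℤP.^-*-assoc k (p ℕ.^ j) p)) ⟩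
    (k ^ (p ℕ.^ j)) ^ p     ≈⟨ fermat (k ^ (p ℕ.^ j)) ⟩
    k ^ (p ℕ.^ j)           ≈⟨ fermat-power j k ⟩
    k                       ∎
    where open ≈-Reasoning

  module PrimePowerShift (j : ℕ) = Shift (ℕP.m^n>0 p (suc j)) (prime-power-vanish (suc j)) (𝓛-+prime-power j)

  module _ (m : ℕ → ℕ) where

    𝒫-digits : ∀ s n → 𝒫 (n ℕ.+ digits₁ p m s) ≈ₚ prodFactors p m s · 𝒫 n
    𝒫-digits zero    n = ≗⇒≈ₚ (λ i → trans (cong (λ x → 𝒫 x i) (ℕP.+-identityʳ n)) (sym (·-identityˡ (𝒫 n) i)))
    𝒫-digits (suc s) n = begin
      𝒫 (n ℕ.+ (D ℕ.+ c ℕ.* Q))      ≡⟨ cong 𝒫 (sym (ℕP.+-assoc n D (c ℕ.* Q))) ⟩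
      𝒫 (n ℕ.+ D ℕ.+ c ℕ.* Q)        ≈⟨ PrimePowerShift.𝒫-shift-multiple s c (n ℕ.+ D) ⟩
      F · 𝒫 (n ℕ.+ D)                ≈⟨ ·-congʳ F (𝒫-digits s n) ⟩
      F · (prodFactors p m s · 𝒫 n)  ≈⟨ ≗⇒≈ₚ (λ i → sym (·-assoc F (prodFactors p m s) (𝒫 n) i)) ⟩
      (F · prodFactors p m s) · 𝒫 n  ≈⟨ ·-congˡ (𝒫 n) (≗⇒≈ₚ (·-comm F (prodFactors p m s))) ⟩
      (prodFactors p m s · F) · 𝒫 n  ∎
      where
      open ≈ₚ-Reasoning
      D = digits₁ p m s
      c = m (suc s)
      Q = p ℕ.^ suc s
      F = xPow+1 Q ^^ c

    eval-𝒫-digits : ∀ k s → eval (suc (digits₁ p m s)) (𝒫 (digits₁ p m s)) k ≈ (k + 1ℤ) ^ sumℕ s (λ i → m (suc i))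
    eval-𝒫-digits k zero    = ≈-refl
    eval-𝒫-digits k (suc s) = begin
      eval (suc (D ℕ.+ c ℕ.* Q)) (𝒫 (D ℕ.+ c ℕ.* Q)) k   ≈⟨ PrimePowerShift.eval-𝒫-shift-multiple s (fermat-power (suc s)) k c D ⟩
      (k + 1ℤ) ^ c * eval (suc D) (𝒫 D) k               ≈⟨ *-cong (≈-refl {(k + 1ℤ) ^ c}) (eval-𝒫-digits k s) ⟩
      (k + 1ℤ) ^ c * (k + 1ℤ) ^ S                       ≡⟨ ℤP.*-comm ((k + 1ℤ) ^ c) _ ⟩
      (k + 1ℤ) ^ S * (k + 1ℤ) ^ c                       ≡⟨ ℤP.^-distribˡ-+-* (k + 1ℤ) S c ⟨
      (k + 1ℤ) ^ (S ℕ.+ c)                              ∎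
      where
      open ≈-Reasoning
      D = digits₁ p m s
      c = m (suc s)
      Q = p ℕ.^ suc s
      S = sumℕ s (λ i → m (suc i))

sumℕ-head : ∀ n (f : ℕ → ℕ) → sumℕ (suc n) f ≡ f 0 ℕ.+ sumℕ n (λ i → f (suc i))
sumℕ-head zero    f = ℕP.+-comm 0 (f 0)
sumℕ-head (suc n) f rewrite sumℕ-head n f = ℕP.+-assoc (f 0) _ _

digits≡head+digits₁ : ∀ p m s → digits p m s ≡ m 0 ℕ.+ digits₁ p m s
digits≡head+digits₁ p m s = trans (sumℕ-head s _) (cong (ℕ._+ digits₁ p m s) (ℕP.*-identityʳ (m 0)))

corollary7 : (p : ℕ) → Prime p → 3 ≤ p → (s : ℕ) → 1 ≤ s →
    (m : ℕ → ℕ) → (∀ i → i ≤ s → m i < p) →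
    (𝒫 (digits p m s) ≡ₚ (prodFactors p m s · 𝒫 (m 0)) [mod p ])
    × (𝒫 (digits₁ p m s) ≡ₚ prodFactors p m s [mod p ])
    × (∀ (k : ℤ) → (+ p) ℤD.∣ (𝒫-eval (digits₁ p m s) k
                                 - (k ℤ.+ + 1) ℤ.^ sumℕ s (λ i → m (suc i))))
corollary7 (suc p₁) p-prime (s≤s _) s _ m _ = ≈ₚ⇒≡ₚ full , ≈ₚ⇒≡ₚ without-m₀ , λ k → ≈⇒∣ (evaluated k)
  where
  open ModPrime p₁ p-prime
  full : 𝒫 (digits p m s) ≈ₚ prodFactors p m s · 𝒫 (m 0)
  full rewrite digits≡head+digits₁ p m s = 𝒫-digits m s (m 0)
  without-m₀ : 𝒫 (digits₁ p m s) ≈ₚ prodFactors p m s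
  without-m₀ i = ≈-trans (𝒫-digits m s 0 i) (≈-reflexive (·-identityʳ-𝒫₀ (prodFactors p m s) i))
  evaluated : ∀ k → 𝒫-eval (digits₁ p m s) k ≈ (k + 1ℤ) ^ sumℕ s (λ i → m (suc i))
  evaluated k rewrite 𝒫-eval≡eval (digits₁ p m s) k = eval-𝒫-digits m k s
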